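{- Let $G$ be a connected graph. Then $KB_e(G)$ is connected if and only if there is no subset of vertices $S \subsetneq V(G)$ such that $N_{\overline{S}}(v)=N_{\overline{S}}(w)$ for every $v,w \in S$ and the induced subgraph $G[S]$ has at least one edge.
   Context: All graphs are finite, simple and undirected. A biclique of a graph $G$ is a maximal induced complete bipartite subgraph of $G$ (a single edge $K_{1,1}$ can be a biclique). The edge-biclique graph $KB_e(G)$ has one vertex for each biclique of $G$, two vertices being adjacent when the corresponding bicliques share at least one edge. For $S\subseteq V(G)$, $\overline{S}=V(G)\setminus S$, and $N_{\overline{S}}(v)=N(v)\cap \overline{S}$ is the neighborhood of $v$ restricted to $\overline{S}$; $G[S]$ is the subgraph induced by $S$. -}

module Defs where

open import Data.Nat using (ℕ)
open import Data.Fin using (Fin)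
open import Data.Bool using (Bool; true; false)
open import Data.Product using (Σ; ∃; _×_; _,_)
open import Data.Sum using (_⊎_)
open import Relation.Nullary using (¬_)
open import Relation.Binary.PropositionalEquality using (_≡_)
open import Relation.Binary.Construct.Closure.ReflexiveTransitive using (Star)
open import Function.Bundles using (_⇔_)
open import Data.Fin.Subset using (Subset; _∈_; _∉_; _⊆_; Nonempty)

record Graph (n : ℕ) : Set where
  field
    adj   : Fin n → Fin n → Bool
    sym   : ∀ u v → adj u v ≡ adj v u
    irrefl : ∀ v → adj v v ≡ false

open Graph public

module _ {n : ℕ} (G : Graph n) where

  Edge : Fin n → Fin n → Set
  Edge u v = adj G u v ≡ true

  Connected : Set
  Connected = ∀ u v → Star Edge u v

  IsInducedCompleteBipartite : Subset n → Set
  IsInducedCompleteBipartite B =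
    Σ (Subset n) λ X → Σ (Subset n) λ Y →
      (∀ v → (v ∈ B) ⇔ (v ∈ X ⊎ v ∈ Y)) ×
      (∀ v → v ∈ X → v ∉ Y) ×
      Nonempty X × Nonempty Y ×
      (∀ u v → u ∈ B → v ∈ B →
         Edge u v ⇔ ((u ∈ X × v ∈ Y) ⊎ (u ∈ Y × v ∈ X)))

  IsBiclique : Subset n → Set
  IsBiclique B =
    IsInducedCompleteBipartite B ×
    (∀ B' → IsInducedCompleteBipartite B' → B ⊆ B' → B' ⊆ B)

  Biclique : Set
  Biclique = Σ (Subset n) IsBiclique

  -- two bicliques share an edge (edges of a biclique are the edges of G
  -- with both ends in it, as it is induced)
  ShareEdge : Biclique → Biclique → Set
  ShareEdge (B , _) (B' , _) =
    ∃ λ u → ∃ λ v → Edge u v × u ∈ B × v ∈ B × u ∈ B' × v ∈ B'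

  KBeConnected : Set
  KBeConnected = ∀ (B B' : Biclique) → Star ShareEdge B B'

module Submission where

-- A biclique containing an edge of a module S lies inside S, hence so does everything linked to it in
-- KB_e(G); in a connected graph an edge leaving a proper module S therefore lies in another component.
-- Conversely, suppose no proper module contains an edge, and fix a component of KB_e(G). The vertices
-- reached from one of its edges along its edges absorb any vertex u that distinguishes two of them (the
-- biclique on an induced path u–z–z′ links zu to the component), so their module hull is all of V(G):
-- every component has an edge at every vertex. Two bicliques C ∋ xp and B ∋ xy are then linked: via a
-- biclique on the path y–x–p, or, if xyp is a triangle, by a "wedge" argument. A wedge at a is an edge uv
-- of the current biclique with au, av in the components of P and Q; it can be carried along any walk in
-- KB_e(G) that avoids both components, but cannot sit on an edge at a. Walking from B to an edge at p
-- (resp. from C to an edge at y) therefore links B (resp. C) with C or with a biclique T ∋ py.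

open import Defs
open import Data.Nat using (ℕ)
open import Data.Fin using (Fin)
open import Data.Fin.Properties using (any?; all?)
open import Data.Fin.Subset using (Subset; _∈_; _∉_; _⊆_; _⊂_; _⊃_; ⊤; ⁅_⁆; _∪_; Nonempty)
open import Data.Fin.Subset.Properties
  using (_∈?_; _⊂?_; nonempty?; anySubset?; ⊆-refl; ⊆-trans; ⊆⊤; ∈⊤; x∈⁅x⁆; x∈⁅y⁆⇒x≡y; p⊆p∪q; q⊆p∪q; x∈p∪q⁻)
open import Data.Fin.Subset.Induction using (⊃-wellFounded; Acc; acc)
open import Data.Bool using (true; false) renaming (_≟_ to _≟ᴮ_)
open import Data.Product using (Σ; ∃; ∃₂; _×_; _,_; proj₁; proj₂)
import Data.Product as Prod
open import Data.Sum using (_⊎_; inj₁; inj₂; [_,_]′)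
import Data.Sum as Sum
open import Data.Empty using (⊥-elim)
open import Relation.Nullary using (¬_; Dec; yes; no)
open import Relation.Nullary.Decidable using (_×-dec_; _⊎-dec_; _→-dec_; ¬?; map′; decidable-stable)
open import Relation.Unary using (Pred)
open import Relation.Binary.PropositionalEquality using (_≡_; _≢_; refl; trans) renaming (sym to ≡-sym)
open import Relation.Binary.Construct.Closure.ReflexiveTransitive using (Star; ε; _◅_; _◅◅_; reverse)
open import Function.Bundles using (_⇔_; mk⇔; Equivalence)

_⇔-dec_ : ∀ {a b} {A : Set a} {B : Set b} → Dec A → Dec B → Dec (A ⇔ B)
a? ⇔-dec b? = map′ (Prod.uncurry mk⇔) (λ e → Equivalence.to e , Equivalence.from e) ((a? →-dec b?) ×-dec (b? →-dec a?))

saturate : ∀ {n p q} {P : Pred (Subset n) p} {Q : Pred (Subset n) q} →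
           (∀ {A} → P A → Q A ⊎ ∃ λ B → A ⊂ B × P B) →
           ∀ {A} → P A → ∃ λ B → A ⊆ B × P B × Q B
saturate {P = P} {Q} step {A} = go (⊃-wellFounded A)
  where
  go : ∀ {A} → Acc _⊃_ A → P A → ∃ λ B → A ⊆ B × P B × Q B
  go {A} (acc rec) pA with step pA
  ... | inj₁ qA = A , ⊆-refl , pA , qA
  ... | inj₂ (B , A⊂B , pB) with go (rec A⊂B) pB
  ...   | C , B⊆C , pC , qC = C , ⊆-trans (proj₁ A⊂B) B⊆C , pC , qC

∈-pair : ∀ {n} {v x y : Fin n} → v ∈ ⁅ x ⁆ ∪ ⁅ y ⁆ → v ≡ x ⊎ v ≡ y
∈-pair {x = x} {y} v∈ = Sum.map (x∈⁅y⁆⇒x≡y x) (x∈⁅y⁆⇒x≡y y) (x∈p∪q⁻ ⁅ x ⁆ ⁅ y ⁆ v∈)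

module _ {n : ℕ} (G : Graph n) where

  Edge-sym : ∀ {u v} → Edge G u v → Edge G v u
  Edge-sym {u} {v} uv = trans (Graph.sym G v u) uv

  Edge-irrefl : ∀ {v} → ¬ Edge G v v
  Edge-irrefl {v} vv with trans (≡-sym vv) (irrefl G v)
  ... | ()

  Edge? : ∀ u v → Dec (Edge G u v)
  Edge? u v = adj G u v ≟ᴮ true

  adj≢⇒separates : ∀ {v w u} → adj G v u ≢ adj G w u →
                   (Edge G v u × ¬ Edge G w u) ⊎ (¬ Edge G v u × Edge G w u)
  adj≢⇒separates {v} {w} {u} ne with adj G v u | adj G w u
  ... | true  | true  = ⊥-elim (ne refl)
  ... | true  | false = inj₁ (refl , λ ())
  ... | false | true  = inj₂ ((λ ()) , refl)
  ... | false | false = ⊥-elim (ne refl)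

  record IsBipartition (D L R : Subset n) : Set where
    field
      left⊆             : L ⊆ D
      right⊆            : R ⊆ D
      covers            : ∀ {v} → v ∈ D → v ∈ L ⊎ v ∈ R
      disjoint          : ∀ {v} → v ∈ L → v ∉ R
      complete          : ∀ {u v} → u ∈ L → v ∈ R → Edge G u v
      left-independent  : ∀ {u v} → u ∈ L → v ∈ L → ¬ Edge G u v
      right-independent : ∀ {u v} → u ∈ R → v ∈ R → ¬ Edge G u v
      left-nonempty     : Nonempty L
      right-nonempty    : Nonempty R

  open IsBipartition

  IsBipartition-swap : ∀ {D L R} → IsBipartition D L R → IsBipartition D R L
  IsBipartition-swap bp = record
    { left⊆ = right⊆ bp ; right⊆ = left⊆ bp
    ; covers = λ v∈D → Sum.swap (covers bp v∈D)
    ; disjoint = λ v∈R v∈L → disjoint bp v∈L v∈R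
    ; complete = λ u∈R v∈L → Edge-sym (complete bp v∈L u∈R)
    ; left-independent = right-independent bp ; right-independent = left-independent bp
    ; left-nonempty = right-nonempty bp ; right-nonempty = left-nonempty bp }

  edge-crosses : ∀ {D L R u v} → IsBipartition D L R → u ∈ D → v ∈ D → Edge G u v →
                 (u ∈ L × v ∈ R) ⊎ (u ∈ R × v ∈ L)
  edge-crosses bp u∈D v∈D uv with covers bp u∈D | covers bp v∈D
  ... | inj₁ u∈L | inj₁ v∈L = ⊥-elim (left-independent bp u∈L v∈L uv)
  ... | inj₁ u∈L | inj₂ v∈R = inj₁ (u∈L , v∈R)
  ... | inj₂ u∈R | inj₁ v∈L = inj₂ (u∈R , v∈L)
  ... | inj₂ u∈R | inj₂ v∈R = ⊥-elim (right-independent bp u∈R v∈R uv)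

  orient : ∀ {D L R u v} → IsBipartition D L R → u ∈ D → v ∈ D → Edge G u v →
           ∃₂ λ L′ R′ → IsBipartition D L′ R′ × u ∈ L′ × v ∈ R′
  orient bp u∈D v∈D uv with edge-crosses bp u∈D v∈D uv
  ... | inj₁ (u∈L , v∈R) = _ , _ , bp , u∈L , v∈R
  ... | inj₂ (u∈R , v∈L) = _ , _ , IsBipartition-swap bp , u∈R , v∈L

  icb⇒bipartition : ∀ {D} → IsInducedCompleteBipartite G D → ∃₂ λ L R → IsBipartition D L R
  icb⇒bipartition {D} (L , R , split , disj , neL , neR , edges) = L , R , record
    { left⊆ = left⊆′ ; right⊆ = right⊆′
    ; covers = λ {v} → Equivalence.to (split v)
    ; disjoint = λ {v} → disj v
    ; complete = λ {u} {v} u∈L v∈R → Equivalence.from (edges u v (left⊆′ u∈L) (right⊆′ v∈R)) (inj₁ (u∈L , v∈R))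
    ; left-independent = λ {u} {v} u∈L v∈L uv →
        [ (λ (_ , v∈R) → disj v v∈L v∈R) , (λ (u∈R , _) → disj u u∈L u∈R) ]′
          (Equivalence.to (edges u v (left⊆′ u∈L) (left⊆′ v∈L)) uv)
    ; right-independent = λ {u} {v} u∈R v∈R uv →
        [ (λ (u∈L , _) → disj u u∈L u∈R) , (λ (_ , v∈L) → disj v v∈L v∈R) ]′
          (Equivalence.to (edges u v (right⊆′ u∈R) (right⊆′ v∈R)) uv)
    ; left-nonempty = neL ; right-nonempty = neR }
    where
    left⊆′ : L ⊆ D
    left⊆′ {v} v∈L = Equivalence.from (split v) (inj₁ v∈L)
    right⊆′ : R ⊆ D
    right⊆′ {v} v∈R = Equivalence.from (split v) (inj₂ v∈R)

  bipartition⇒icb : ∀ {D L R} → IsBipartition D L R → IsInducedCompleteBipartite G D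
  bipartition⇒icb {L = L} {R} bp =
    L , R , (λ v → mk⇔ (covers bp) [ left⊆ bp , right⊆ bp ]′) , (λ v → disjoint bp) ,
    left-nonempty bp , right-nonempty bp ,
    λ u v u∈D v∈D → mk⇔ (edge-crosses bp u∈D v∈D)
      [ (λ (u∈L , v∈R) → complete bp u∈L v∈R) , (λ (u∈R , v∈L) → Edge-sym (complete bp v∈L u∈R)) ]′

  isInducedCompleteBipartite? : ∀ D → Dec (IsInducedCompleteBipartite G D)
  isInducedCompleteBipartite? D = anySubset? λ L → anySubset? λ R →
    all? (λ v → (v ∈? D) ⇔-dec ((v ∈? L) ⊎-dec (v ∈? R)))
    ×-dec all? (λ v → (v ∈? L) →-dec ¬? (v ∈? R))
    ×-dec nonempty? L ×-dec nonempty? R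
    ×-dec all? (λ u → all? λ v → (u ∈? D) →-dec (v ∈? D) →-dec
            (Edge? u v ⇔-dec (((u ∈? L) ×-dec (v ∈? R)) ⊎-dec ((u ∈? R) ×-dec (v ∈? L)))))

  _∈ᴮ_ : Fin n → Biclique G → Set
  v ∈ᴮ B = v ∈ proj₁ B

  bipartition : (B : Biclique G) → ∃₂ λ L R → IsBipartition (proj₁ B) L R
  bipartition (_ , icb , _) = icb⇒bipartition icb

  extend-to-biclique : ∀ {D L R} → IsBipartition D L R → Σ (Biclique G) λ B → D ⊆ proj₁ B
  extend-to-biclique bp with saturate step (bipartition⇒icb bp)
    where
    Maximal : Subset n → Set
    Maximal A = ∀ B → IsInducedCompleteBipartite G B → A ⊆ B → B ⊆ A
    step : ∀ {A} → IsInducedCompleteBipartite G A →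
           Maximal A ⊎ ∃ λ B → A ⊂ B × IsInducedCompleteBipartite G B
    step {A} _ with anySubset? (λ B → isInducedCompleteBipartite? B ×-dec A ⊂? B)
    ... | yes (B , icb , A⊂B) = inj₂ (B , A⊂B , icb)
    ... | no ¬bigger = inj₁ λ B icb A⊆B {x} x∈B →
          decidable-stable (x ∈? A) λ x∉A → ¬bigger (B , icb , A⊆B , x , x∈B , x∉A)
  ... | B , D⊆B , icb , maximal = (B , icb , maximal) , D⊆B

  star-bipartition : ∀ {c R} → Nonempty R → (∀ {v} → v ∈ R → Edge G c v) →
                     (∀ {u v} → u ∈ R → v ∈ R → ¬ Edge G u v) → IsBipartition (⁅ c ⁆ ∪ R) ⁅ c ⁆ R
  star-bipartition {c} {R} neR c—R indep = record
    { left⊆ = p⊆p∪q R ; right⊆ = q⊆p∪q ⁅ c ⁆ R ; covers = x∈p∪q⁻ ⁅ c ⁆ R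
    ; disjoint = λ {u} u∈c u∈R → Edge-irrefl (centre {P = λ w → Edge G w u} u∈c (c—R u∈R))
    ; complete = λ {_} {v} u∈c v∈R → centre {P = λ w → Edge G w v} u∈c (c—R v∈R)
    ; left-independent = λ {_} {v} u∈c v∈c →
        centre {P = λ w → ¬ Edge G w v} u∈c (centre {P = λ w → ¬ Edge G c w} v∈c Edge-irrefl)
    ; right-independent = indep
    ; left-nonempty = c , x∈⁅x⁆ c ; right-nonempty = neR }
    where
    centre : ∀ {u} {P : Fin n → Set} → u ∈ ⁅ c ⁆ → P c → P u
    centre u∈c Pc with x∈⁅y⁆⇒x≡y c u∈c
    ... | refl = Pc

  path-biclique : ∀ {x y z} → Edge G x y → Edge G y z → ¬ Edge G x z →
                  Σ (Biclique G) λ B → x ∈ᴮ B × y ∈ᴮ B × z ∈ᴮ B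
  path-biclique {x} {y} {z} xy yz ¬xz =
    B , ⊆B (q⊆p∪q ⁅ y ⁆ _ x∈leaves) , ⊆B (p⊆p∪q _ (x∈⁅x⁆ y)) , ⊆B (q⊆p∪q ⁅ y ⁆ _ z∈leaves)
    where
    x∈leaves = p⊆p∪q ⁅ z ⁆ (x∈⁅x⁆ x)
    z∈leaves = q⊆p∪q ⁅ x ⁆ ⁅ z ⁆ (x∈⁅x⁆ z)
    y—leaf : ∀ {v} → v ∈ ⁅ x ⁆ ∪ ⁅ z ⁆ → Edge G y v
    y—leaf v∈ with ∈-pair v∈
    ... | inj₁ refl = Edge-sym xy
    ... | inj₂ refl = yz
    independent : ∀ {u v} → u ∈ ⁅ x ⁆ ∪ ⁅ z ⁆ → v ∈ ⁅ x ⁆ ∪ ⁅ z ⁆ → ¬ Edge G u v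
    independent u∈ v∈ with ∈-pair u∈ | ∈-pair v∈
    ... | inj₁ refl | inj₁ refl = Edge-irrefl
    ... | inj₁ refl | inj₂ refl = ¬xz
    ... | inj₂ refl | inj₁ refl = λ zx → ¬xz (Edge-sym zx)
    ... | inj₂ refl | inj₂ refl = Edge-irrefl
    extension = extend-to-biclique (star-bipartition (x , x∈leaves) y—leaf independent)
    B = proj₁ extension
    ⊆B = proj₂ extension

  edge-biclique : ∀ {x y} → Edge G x y → Σ (Biclique G) λ B → x ∈ᴮ B × y ∈ᴮ B
  edge-biclique xy with path-biclique xy (Edge-sym xy) Edge-irrefl
  ... | B , x∈B , y∈B , _ = B , x∈B , y∈B

  Linked : Biclique G → Biclique G → Set
  Linked = Star (ShareEdge G)

  Linked-sym : ∀ {C D} → Linked C D → Linked D C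
  Linked-sym = reverse λ (u , v , uv , u∈C , v∈C , u∈D , v∈D) → u , v , uv , u∈D , v∈D , u∈C , v∈C

  linked-by : ∀ {u v} (C D : Biclique G) → Edge G u v → u ∈ᴮ C → v ∈ᴮ C → u ∈ᴮ D → v ∈ᴮ D → Linked C D
  linked-by {u} {v} _ _ uv u∈C v∈C u∈D v∈D = (u , v , uv , u∈C , v∈C , u∈D , v∈D) ◅ ε

  Covers : Biclique G → Fin n → Fin n → Set
  Covers K u v = Σ (Biclique G) λ C → Linked K C × u ∈ᴮ C × v ∈ᴮ C × Edge G u v

  Covers-sym : ∀ {K u v} → Covers K u v → Covers K v u
  Covers-sym (C , KC , u∈C , v∈C , uv) = C , KC , v∈C , u∈C , Edge-sym uv

  Covers⇒Edge : ∀ {K u v} → Covers K u v → Edge G u v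
  Covers⇒Edge (_ , _ , _ , _ , uv) = uv

  covers-self : ∀ {u v} (K : Biclique G) → u ∈ᴮ K → v ∈ᴮ K → Edge G u v → Covers K u v
  covers-self K u∈K v∈K uv = K , ε , u∈K , v∈K , uv

  covers-transfer : ∀ {K u w s t} → Covers K u w → (T : Biclique G) →
                    u ∈ᴮ T → w ∈ᴮ T → s ∈ᴮ T → t ∈ᴮ T → Edge G s t → Covers K s t
  covers-transfer (C , KC , u∈C , w∈C , uw) T u∈T w∈T s∈T t∈T st =
    T , KC ◅◅ linked-by C T uw u∈C w∈C u∈T w∈T , s∈T , t∈T , st

  -- Along the walk, the first vertex z′ not adjacent to u follows a neighbour z of u,
  -- and the biclique on the path u–z–z′ carries the edge zu.
  reach-non-neighbour : ∀ {K u z w} → Star (Covers K) z w → Edge G z u → ¬ Edge G w u → Star (Covers K) z u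
  reach-non-neighbour ε zu ¬wu = ⊥-elim (¬wu zu)
  reach-non-neighbour {u = u} (_◅_ {j = z′} zz′ walk) zu ¬wu with Edge? z′ u
  ... | yes z′u = zz′ ◅ reach-non-neighbour walk z′u ¬wu
  ... | no ¬z′u with path-biclique (Edge-sym zu) (Covers⇒Edge zz′) (λ uz′ → ¬z′u (Edge-sym uz′))
  ...   | T , u∈T , z∈T , z′∈T = covers-transfer zz′ T z∈T z′∈T z∈T u∈T zu ◅ ε

  covered-endpoint : ∀ {K a b z} → Covers K a b → Star (Covers K) a z → ∃ λ q → Covers K z q
  covered-endpoint ab ε = _ , ab
  covered-endpoint _ (az′ ◅ walk) = covered-endpoint (Covers-sym az′) walk

  IsModule : Subset n → Set
  IsModule S = ∀ v w → v ∈ S → w ∈ S → ∀ u → u ∉ S → adj G v u ≡ adj G w u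

  ProperModuleWithEdge : Set
  ProperModuleWithEdge =
    Σ (Subset n) λ S → S ⊂ ⊤ × IsModule S × (∃ λ x → ∃ λ y → x ∈ S × y ∈ S × Edge G x y)

  SeparatorClosed : ∀ {ℓ} → Pred (Fin n) ℓ → Set ℓ
  SeparatorClosed R = ∀ {v w u} → R v → R w → adj G v u ≢ adj G w u → R u

  module-hull : ∀ {ℓ} {R : Pred (Fin n) ℓ} → SeparatorClosed R →
                ∀ {M₀} → (∀ {m} → m ∈ M₀ → R m) →
                ∃ λ M → M₀ ⊆ M × (∀ {m} → m ∈ M → R m) × IsModule M
  module-hull {R = R} closed = saturate step
    where
    step : ∀ {M} → (∀ {m} → m ∈ M → R m) → IsModule M ⊎ ∃ λ M′ → M ⊂ M′ × (∀ {m} → m ∈ M′ → R m)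
    step {M} inR with any? (λ v → any? λ w → any? λ u →
                        (v ∈? M) ×-dec (w ∈? M) ×-dec ¬? (u ∈? M) ×-dec ¬? (adj G v u ≟ᴮ adj G w u))
    ... | yes (v , w , u , v∈M , w∈M , u∉M , separates) =
          inj₂ (M ∪ ⁅ u ⁆ , (p⊆p∪q ⁅ u ⁆ , u , q⊆p∪q M ⁅ u ⁆ (x∈⁅x⁆ u) , u∉M) , inR′)
      where
      inR′ : ∀ {m} → m ∈ M ∪ ⁅ u ⁆ → R m
      inR′ m∈ with x∈p∪q⁻ M ⁅ u ⁆ m∈
      ... | inj₁ m∈M = inR m∈M
      ... | inj₂ m∈u with x∈⁅y⁆⇒x≡y u m∈u
      ...   | refl = closed (inR v∈M) (inR w∈M) separates
    ... | no none = inj₁ λ v w v∈M w∈M u u∉M →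
          decidable-stable (adj G v u ≟ᴮ adj G w u) λ ne → none (v , w , u , v∈M , w∈M , u∉M , ne)

  separator-closed-everywhere : ¬ ProperModuleWithEdge → ∀ {ℓ} {R : Pred (Fin n) ℓ} → SeparatorClosed R →
                                ∀ {a b} → Edge G a b → R a → R b → ∀ z → R z
  separator-closed-everywhere noModule {R = R} closed {a} {b} ab Ra Rb z
    with module-hull closed {⁅ a ⁆ ∪ ⁅ b ⁆} endpoints
    where
    endpoints : ∀ {m} → m ∈ ⁅ a ⁆ ∪ ⁅ b ⁆ → R m
    endpoints m∈ with ∈-pair m∈
    ... | inj₁ refl = Ra
    ... | inj₂ refl = Rb
  ... | M , ab⊆M , inR , module-M with z ∈? M
  ...   | yes z∈M = inR z∈M
  ...   | no z∉M = ⊥-elim (noModule (M , (⊆⊤ , z , ∈⊤ , z∉M) , module-M , a , b ,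
                                     ab⊆M (p⊆p∪q ⁅ b ⁆ (x∈⁅x⁆ a)) , ab⊆M (q⊆p∪q ⁅ a ⁆ ⁅ b ⁆ (x∈⁅x⁆ b)) , ab))

  reachable-separator-closed : ∀ {K a} → SeparatorClosed (Star (Covers K) a)
  reachable-separator-closed av aw separates with adj≢⇒separates separates
  ... | inj₁ (vu , ¬wu) = av ◅◅ reach-non-neighbour (reverse Covers-sym av ◅◅ aw) vu ¬wu
  ... | inj₂ (¬vu , wu) = aw ◅◅ reach-non-neighbour (reverse Covers-sym aw ◅◅ av) wu ¬vu

  every-vertex-covered : ¬ ProperModuleWithEdge → (K : Biclique G) → ∀ z → ∃ λ q → Covers K z q
  every-vertex-covered noModule K z with bipartition K
  ... | _ , _ , bp with left-nonempty bp | right-nonempty bp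
  ...   | x , x∈L | y , y∈R =
    covered-endpoint xy (separator-closed-everywhere noModule reachable-separator-closed
                           (Covers⇒Edge xy) ε (xy ◅ ε) z)
    where
    xy : Covers K x y
    xy = covers-self K (left⊆ bp x∈L) (right⊆ bp y∈R) (complete bp x∈L y∈R)

  Wedge : Fin n → Biclique G → Biclique G → Fin n → Fin n → Set
  Wedge a P Q u v = Covers P a u × Covers Q a v

  WedgeIn : Fin n → Biclique G → Biclique G → Biclique G → Set
  WedgeIn a P Q D = ∃ λ s → ∃ λ t → s ∈ᴮ D × t ∈ᴮ D × Edge G s t × Wedge a P Q s t

  LinkedToEither : Biclique G → Biclique G → Biclique G → Set
  LinkedToEither P Q D = Linked P D ⊎ Linked Q D

  LinkedToEither-◅◅ : ∀ {P Q D D′} → LinkedToEither P Q D → Linked D D′ → LinkedToEither P Q D′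
  LinkedToEither-◅◅ linked DD′ = Sum.map (_◅◅ DD′) (_◅◅ DD′) linked

  -- If a ≁ v′ the path a–u–v′ links the P-edge au to D;
  -- otherwise the path v–a–v′ carries av′ into Q's component.
  wedge-pivot : ∀ {a P Q u v v′} (D : Biclique G) → Wedge a P Q u v → Edge G u v′ → ¬ Edge G v v′ →
                u ∈ᴮ D → v′ ∈ᴮ D → LinkedToEither P Q D ⊎ Wedge a P Q u v′
  wedge-pivot {a} {v′ = v′} D (au , av) uv′ ¬vv′ u∈D v′∈D with Edge? a v′
  ... | no ¬av′ with path-biclique (Covers⇒Edge au) uv′ ¬av′ | au
  ...   | T , a∈T , u∈T , v′∈T | C , PC , a∈C , u∈C , a~u =
    inj₁ (inj₁ (PC ◅◅ linked-by C T a~u a∈C u∈C a∈T u∈T ◅◅ linked-by T D uv′ u∈T v′∈T u∈D v′∈D))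
  wedge-pivot D (au , av) uv′ ¬vv′ u∈D v′∈D | yes av′ with path-biclique (Edge-sym (Covers⇒Edge av)) av′ ¬vv′
  ... | T , v∈T , a∈T , v′∈T = inj₂ (au , covers-transfer av T a∈T v∈T a∈T v′∈T av′)

  wedge-spreads : ∀ {a P Q L R l r u v} (D : Biclique G) → IsBipartition (proj₁ D) L R →
                  Wedge a P Q l r → l ∈ L → r ∈ R → u ∈ L → v ∈ R → LinkedToEither P Q D ⊎ Wedge a P Q u v
  wedge-spreads D bp w l∈L r∈R u∈L v∈R
    with wedge-pivot D w (complete bp l∈L v∈R) (right-independent bp r∈R v∈R) (left⊆ bp l∈L) (right⊆ bp v∈R)
  ... | inj₁ linked = inj₁ linked
  ... | inj₂ w′ = Sum.map Sum.swap Prod.swap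
        (wedge-pivot D (Prod.swap w′) (Edge-sym (complete bp u∈L v∈R)) (left-independent bp l∈L u∈L)
                     (right⊆ bp v∈R) (left⊆ bp u∈L))

  wedge-reaches : ∀ {a P Q} (D : Biclique G) → WedgeIn a P Q D → ∀ {u v} → u ∈ᴮ D → v ∈ᴮ D → Edge G u v →
                  LinkedToEither P Q D ⊎ (Wedge a P Q u v ⊎ Wedge a P Q v u)
  wedge-reaches D (s , t , s∈D , t∈D , st , w) u∈D v∈D uv with bipartition D
  ... | _ , _ , bp with orient bp s∈D t∈D st
  ...   | _ , _ , bp′ , s∈L , t∈R with edge-crosses bp′ u∈D v∈D uv
  ...     | inj₁ (u∈L , v∈R) = Sum.map₂ inj₁ (wedge-spreads D bp′ w s∈L t∈R u∈L v∈R)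
  ...     | inj₂ (u∈R , v∈L) = Sum.map₂ inj₂ (wedge-spreads D bp′ w s∈L t∈R v∈L u∈R)

  wedge-travels : ∀ {a P Q D D′} → Linked D D′ → WedgeIn a P Q D → LinkedToEither P Q D′ ⊎ WedgeIn a P Q D′
  wedge-travels ε w = inj₂ w
  wedge-travels {D = D} (share@(u , v , uv , u∈D , v∈D , u∈D₁ , v∈D₁) ◅ walk) w with wedge-reaches D w u∈D v∈D uv
  ... | inj₁ linked = inj₁ (LinkedToEither-◅◅ linked (share ◅ walk))
  ... | inj₂ (inj₁ w′) = wedge-travels walk (u , v , u∈D₁ , v∈D₁ , uv , w′)
  ... | inj₂ (inj₂ w′) = wedge-travels walk (v , u , v∈D₁ , u∈D₁ , Edge-sym uv , w′)

  wedge-linked : ¬ ProperModuleWithEdge → ∀ {a P Q} (R : Biclique G) → WedgeIn a P Q R → LinkedToEither P Q R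
  wedge-linked noModule {a} R w with every-vertex-covered noModule R a
  ... | q , D , RD , a∈D , q∈D , aq with wedge-travels RD w
  ...   | inj₁ linked = LinkedToEither-◅◅ linked (Linked-sym RD)
  ...   | inj₂ w′ with wedge-reaches D w′ a∈D q∈D aq
  ...     | inj₁ linked = LinkedToEither-◅◅ linked (Linked-sym RD)
  ...     | inj₂ (inj₁ (aa , _)) = ⊥-elim (Edge-irrefl (Covers⇒Edge aa))
  ...     | inj₂ (inj₂ (_ , aa)) = ⊥-elim (Edge-irrefl (Covers⇒Edge aa))

  incident-edges-linked : ¬ ProperModuleWithEdge → ∀ {x y p} (C B : Biclique G) →
                          x ∈ᴮ C → p ∈ᴮ C → Edge G x p → x ∈ᴮ B → y ∈ᴮ B → Edge G x y → Linked C B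
  incident-edges-linked noModule {y = y} {p} C B x∈C p∈C xp x∈B y∈B xy with Edge? p y
  ... | no ¬py with path-biclique (Edge-sym xy) xp (λ yp → ¬py (Edge-sym yp))
  ...   | T , y∈T , x∈T , p∈T = linked-by C T xp x∈C p∈C x∈T p∈T ◅◅ linked-by T B xy x∈T y∈T x∈B y∈B
  incident-edges-linked noModule C B x∈C p∈C xp x∈B y∈B xy | yes py with edge-biclique py
  ... | T , p∈T , y∈T
    with wedge-linked noModule B (_ , _ , x∈B , y∈B , xy , covers-self C p∈C x∈C (Edge-sym xp) , covers-self T p∈T y∈T py)
  ...   | inj₁ CB = CB
  ...   | inj₂ TB
    with wedge-linked noModule C (_ , _ , x∈C , p∈C , xp , covers-self B y∈B x∈B (Edge-sym xy) , covers-self T y∈T p∈T (Edge-sym py))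
  ...     | inj₁ BC = Linked-sym BC
  ...     | inj₂ TC = Linked-sym TC ◅◅ TB

  backward : ¬ ProperModuleWithEdge → KBeConnected G
  backward noModule B₀ B with bipartition B
  ... | _ , _ , bp with left-nonempty bp | right-nonempty bp
  ...   | x , x∈L | y , y∈R with every-vertex-covered noModule B₀ x
  ...     | p , C , B₀C , x∈C , p∈C , xp =
    B₀C ◅◅ incident-edges-linked noModule C B x∈C p∈C xp (left⊆ bp x∈L) (right⊆ bp y∈R) (complete bp x∈L y∈R)

  walk-exits : ∀ {S x z} → Star (Edge G) x z → x ∈ S → z ∉ S → ∃ λ s → ∃ λ u → s ∈ S × u ∉ S × Edge G s u
  walk-exits ε x∈S z∉S = ⊥-elim (z∉S x∈S)
  walk-exits {S} (_◅_ {j = x′} xx′ walk) x∈S z∉S with x′ ∈? S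
  ... | yes x′∈S = walk-exits walk x′∈S z∉S
  ... | no x′∉S = _ , x′ , x∈S , x′∉S , xx′

  biclique-⊆-module : ∀ {S a b} → IsModule S → (D : Biclique G) → a ∈ᴮ D → b ∈ᴮ D → a ∈ S → b ∈ S →
                      Edge G a b → proj₁ D ⊆ S
  biclique-⊆-module {S} {a} {b} module-S D a∈D b∈D a∈S b∈S ab {c} c∈D with bipartition D
  ... | _ , _ , bp with orient bp a∈D b∈D ab
  ...   | _ , _ , bp′ , a∈L , b∈R = decidable-stable (c ∈? S) λ c∉S → [
          (λ c∈L → left-independent bp′ a∈L c∈L
                     (trans (≡-sym (module-S b a b∈S a∈S c c∉S)) (Edge-sym (complete bp′ c∈L b∈R)))) ,
          (λ c∈R → right-independent bp′ b∈R c∈R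
                     (trans (≡-sym (module-S a b a∈S b∈S c c∉S)) (complete bp′ a∈L c∈R))) ]′
        (covers bp′ c∈D)

  linked-⊆-module : ∀ {S D D′} → IsModule S → Linked D D′ → proj₁ D ⊆ S → proj₁ D′ ⊆ S
  linked-⊆-module module-S ε D⊆S = D⊆S
  linked-⊆-module module-S (_◅_ {j = D₁} (u , v , uv , u∈D , v∈D , u∈D₁ , v∈D₁) walk) D⊆S =
    linked-⊆-module module-S walk (biclique-⊆-module module-S D₁ u∈D₁ v∈D₁ (D⊆S u∈D) (D⊆S v∈D) uv)

  forward : Connected G → KBeConnected G → ¬ ProperModuleWithEdge
  forward connected linked (S , (_ , z , _ , z∉S) , module-S , x , y , x∈S , y∈S , xy)
    with walk-exits (connected x z) x∈S z∉S
  ... | s , u , s∈S , u∉S , su with edge-biclique xy | edge-biclique su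
  ...   | C , x∈C , y∈C | D , s∈D , u∈D =
    u∉S (linked-⊆-module module-S (linked C D) (biclique-⊆-module module-S C x∈C y∈C x∈S y∈S xy) u∈D)

theorem1 : ∀ {n : ℕ} (G : Graph n) → Connected G →
    KBeConnected G ⇔
      (¬ (Σ (Subset n) λ S → S ⊂ ⊤ ×
            (∀ v w → v ∈ S → w ∈ S → ∀ u → u ∉ S → adj G v u ≡ adj G w u) ×
            (∃ λ x → ∃ λ y → x ∈ S × y ∈ S × Edge G x y)))
theorem1 G connected = mk⇔ (forward G connected) (backward G)
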